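{- Let $(f_n)_{n\ge0}$ be the regular paper-folding sequence defined by $f_{2n+1}=f_n$, $f_{4n}=0$, $f_{4n+2}=1$ for all $n\ge 0$. Then the running sum $\mathrm{sum}_{\mathrm{pf}}(n)=\sum_{i=0}^{n} f_i$ is not $2$-synchronised.
   Context: A function $f:\mathbb{N}\to\mathbb{N}$ is $2$-synchronised if there is a finite automaton which, reading the base-$2$ representations of $n$ and $m$ in parallel (most significant digit first, the shorter padded with leading zeros), accepts exactly the pairs $(n,m)$ with $m = f(n)$. -}

module Defs where

open import Data.Nat using (ℕ; zero; suc; _+_; _*_; _∸_; _⊔_; _≡ᵇ_; _/_; _%_)
open import Data.Bool using (Bool; true; false; T)
open import Data.Fin using (Fin)
open import Data.List using (List; []; _∷_; _++_; reverse; replicate; length; zip; foldl)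
open import Data.Product using (_×_; Σ; _,_)
open import Relation.Binary.PropositionalEquality using (_≡_)
open import Function.Bundles using (_⇔_)

-- Least-significant-digit-first binary digits (true = 1), with fuel.
-- Fuel n is always enough for the number n; 0 has the empty representation.
lsbDigits : ℕ → ℕ → List Bool
lsbDigits zero    _       = []
lsbDigits (suc k) zero    = []
lsbDigits (suc k) (suc n) = ((suc n % 2) ≡ᵇ 1) ∷ lsbDigits k (suc n / 2)

bin : ℕ → List Bool
bin n = reverse (lsbDigits n n)

padTo : ℕ → List Bool → List Bool
padTo k xs = replicate (k ∸ length xs) false ++ xs

pairRep : ℕ → ℕ → List (Bool × Bool)
pairRep n m = zip (padTo L (bin n)) (padTo L (bin m))
  where L = length (bin n) ⊔ length (bin m)

record DFA : Set where
  field
    size   : ℕ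
    start  : Fin size
    δ      : Fin size → Bool × Bool → Fin size
    accept : Fin size → Bool

accepts : DFA → List (Bool × Bool) → Bool
accepts A w = DFA.accept A (foldl (DFA.δ A) (DFA.start A) w)

Synchronised2 : (ℕ → ℕ) → Set
Synchronised2 f =
  Σ DFA λ A → ∀ n m → T (accepts A (pairRep n m)) ⇔ (m ≡ f n)

runningSum : (ℕ → ℕ) → ℕ → ℕ
runningSum f zero    = f 0
runningSum f (suc n) = runningSum f n + f (suc n)

{-# OPTIONS --safe #-}

-- Write S for the running sum and say that x has defect c when S(2x) + c = x.
-- Splitting off odd and even indices gives S(2n+1) = S(n) + E(n), where E(n) = ⌈n/2⌉
-- counts the indices 4k+2 up to 2n. Hence appending the digit 1 to x keeps its defect
-- and appending 10 raises it by one, so x = 1(10)^i 1^K has defect i for every K.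
-- An automaton reading (2x, S(2x)) = (1(10)^i 1^K 0, 0 1(10)^i w), where w is the
-- K-digit complement of i, accepts the suffix (1^(K-1) 0, w) after the common prefix
-- (1(10)^i 1, 0 1(10)^i) only for that i. So the state reached after the prefix
-- determines i, which is impossible once i takes more values than there are states.

module Submission where

open import Defs
open import Data.Nat using (ℕ; _+_; _*_)
open import Relation.Binary.PropositionalEquality using (_≡_)
open import Relation.Nullary using (¬_)

open import Data.Nat using (zero; suc; _≤_; _<_; _^_; _/_; _%_; _⊔_; _≡ᵇ_; NonZero; z≤n; s≤s; z<s)
open import Data.Nat.Properties
open import Data.Nat.DivMod using (m/n<m; +-distrib-/-∣ˡ; m*n/n≡m; [m+kn]%n≡m%n; /-congˡ)
open import Data.Nat.Divisibility using (m∣m*n)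
open import Data.Nat.Tactic.RingSolver using (solve; solve-∀)
open import Data.Bool using (Bool; true; false; not; T)
open import Data.List using (List; []; _∷_; _++_; map; reverse; replicate; length; zip; foldl)
open import Data.List.Properties using (++-assoc; ++-identityʳ; foldl-++; length-++; length-map; length-replicate; unfold-reverse)
open import Data.Product using (Σ; ∃₂; _×_; _,_; proj₁; proj₂)
open import Data.Fin using (Fin; toℕ)
open import Data.Fin.Properties using (pigeonhole; toℕ<n)
open import Function.Bundles using (_⇔_; mk⇔; Equivalence)
open import Function.Properties.Equivalence using () renaming (trans to ⇔-trans)
open import Relation.Binary.PropositionalEquality using (refl; sym; trans; cong; cong₂; subst; module ≡-Reasoning)

open ≡-Reasoning

bit : Bool → ℕ
bit false = 0
bit true  = 1

appendDigits : ℕ → List Bool → ℕ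
appendDigits x []       = x
appendDigits x (b ∷ bs) = appendDigits (2 * x + bit b) bs

appendDigits-++ : ∀ x bs cs → appendDigits x (bs ++ cs) ≡ appendDigits (appendDigits x bs) cs
appendDigits-++ x []       cs = refl
appendDigits-++ x (b ∷ bs) cs = appendDigits-++ (2 * x + bit b) bs cs

[2x+b]/2≡x : ∀ x b → (2 * x + bit b) / 2 ≡ x
[2x+b]/2≡x x b = begin
  (2 * x + bit b) / 2   ≡⟨ +-distrib-/-∣ˡ (bit b) (m∣m*n x) ⟩
  2 * x / 2 + bit b / 2 ≡⟨ cong₂ _+_ (trans (/-congˡ (*-comm 2 x)) (m*n/n≡m x 2)) (bit/2≡0 b) ⟩
  x + 0                 ≡⟨ +-identityʳ x ⟩
  x                     ∎
  where
  bit/2≡0 : ∀ b → bit b / 2 ≡ 0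
  bit/2≡0 false = refl
  bit/2≡0 true  = refl

[2x+b]%2≡b : ∀ x b → ((2 * x + bit b) % 2 ≡ᵇ 1) ≡ b
[2x+b]%2≡b x b = begin
  ((2 * x + bit b) % 2 ≡ᵇ 1)
    ≡⟨ cong (λ n → n % 2 ≡ᵇ 1) (trans (+-comm (2 * x) (bit b)) (cong (bit b +_) (*-comm 2 x))) ⟩
  ((bit b + x * 2) % 2 ≡ᵇ 1) ≡⟨ cong (_≡ᵇ 1) ([m+kn]%n≡m%n (bit b) x 2) ⟩
  (bit b % 2 ≡ᵇ 1)           ≡⟨ bit%2 b ⟩
  b                          ∎
  where
  bit%2 : ∀ b → (bit b % 2 ≡ᵇ 1) ≡ b
  bit%2 false = refl
  bit%2 true  = refl

[1+n]/2≤n : ∀ n → suc n / 2 ≤ n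
[1+n]/2≤n n = ≤-pred (m/n<m (suc n) 2 (s≤s (s≤s z≤n)))

lsbDigits-fuel : ∀ {k k′ n} → n ≤ k → n ≤ k′ → lsbDigits k n ≡ lsbDigits k′ n
lsbDigits-fuel {zero}  {zero}   z≤n z≤n = refl
lsbDigits-fuel {zero}  {suc _}  z≤n z≤n = refl
lsbDigits-fuel {suc _} {zero}   z≤n z≤n = refl
lsbDigits-fuel {suc _} {suc _}  z≤n z≤n = refl
lsbDigits-fuel {suc k} {suc k′} {suc n} (s≤s n≤k) (s≤s n≤k′) =
  cong (_ ∷_) (lsbDigits-fuel (≤-trans ([1+n]/2≤n n) n≤k) (≤-trans ([1+n]/2≤n n) n≤k′))

bin-unfold : ∀ n .{{_ : NonZero n}} → bin n ≡ bin (n / 2) ++ (n % 2 ≡ᵇ 1) ∷ []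
bin-unfold (suc n) = begin
  reverse (b ∷ lsbDigits n (suc n / 2))
    ≡⟨ cong (λ ds → reverse (b ∷ ds)) (lsbDigits-fuel ([1+n]/2≤n n) ≤-refl) ⟩
  reverse (b ∷ lsbDigits (suc n / 2) (suc n / 2))  ≡⟨ unfold-reverse b (lsbDigits (suc n / 2) (suc n / 2)) ⟩
  bin (suc n / 2) ++ b ∷ []                        ∎
  where
  b : Bool
  b = suc n % 2 ≡ᵇ 1

bin-snoc : ∀ x b → bin (2 * suc x + bit b) ≡ bin (suc x) ++ b ∷ []
bin-snoc x b = begin
  bin (2 * suc x + bit b)
    ≡⟨ bin-unfold (2 * suc x + bit b) ⟩
  bin ((2 * suc x + bit b) / 2) ++ ((2 * suc x + bit b) % 2 ≡ᵇ 1) ∷ []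
    ≡⟨ cong₂ (λ y c → bin y ++ c ∷ []) ([2x+b]/2≡x (suc x) b) ([2x+b]%2≡b (suc x) b) ⟩
  bin (suc x) ++ b ∷ [] ∎

bin-appendDigits : ∀ {x} bs → 1 ≤ x → bin (appendDigits x bs) ≡ bin x ++ bs
bin-appendDigits {x} [] _ = sym (++-identityʳ (bin x))
bin-appendDigits {suc x} (b ∷ bs) _ = begin
  bin (appendDigits (2 * suc x + bit b) bs) ≡⟨ bin-appendDigits bs z<s ⟩
  bin (2 * suc x + bit b) ++ bs             ≡⟨ cong (_++ bs) (bin-snoc x b) ⟩
  (bin (suc x) ++ b ∷ []) ++ bs             ≡⟨ ++-assoc (bin (suc x)) (b ∷ []) bs ⟩
  bin (suc x) ++ b ∷ bs                     ∎

padTo-+ : ∀ {L} k (xs : List Bool) → k + length xs ≡ L → padTo L xs ≡ replicate k false ++ xs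
padTo-+ k xs refl = cong (λ j → replicate j false ++ xs) (m+n∸n≡m k (length xs))

pairRep-oneDigitLonger : ∀ {n m} → length (bin n) ≡ suc (length (bin m)) →
                         pairRep n m ≡ zip (bin n) (false ∷ bin m)
pairRep-oneDigitLonger {n} {m} ℓn≡1+ℓm =
  cong₂ zip (padTo-+ 0 (bin n) (sym L≡ℓn)) (padTo-+ 1 (bin m) (trans (sym ℓn≡1+ℓm) (sym L≡ℓn)))
  where
  L≡ℓn : length (bin n) ⊔ length (bin m) ≡ length (bin n)
  L≡ℓn = m≥n⇒m⊔n≡m (≤-trans (n≤1+n _) (≤-reflexive (sym ℓn≡1+ℓm)))

zip-++ : ∀ {A B : Set} (xs : List A) (ys : List B) {us vs} → length xs ≡ length ys →
         zip (xs ++ us) (ys ++ vs) ≡ zip xs ys ++ zip us vs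
zip-++ []       []       _  = refl
zip-++ (x ∷ xs) (y ∷ ys) ℓ≡ = cong ((x , y) ∷_) (zip-++ xs ys (suc-injective ℓ≡))

pairRep-appendDigits : ∀ {x} b u v → 1 ≤ x → length u ≡ length v →
  pairRep (appendDigits x (b ∷ u)) (appendDigits x v) ≡ zip (bin x ++ b ∷ []) (false ∷ bin x) ++ zip u v
pairRep-appendDigits {x} b u v 1≤x ℓu≡ℓv = begin
  pairRep (appendDigits x (b ∷ u)) (appendDigits x v)
    ≡⟨ pairRep-oneDigitLonger {appendDigits x (b ∷ u)} {appendDigits x v} lengths ⟩
  zip (bin (appendDigits x (b ∷ u))) (false ∷ bin (appendDigits x v))
    ≡⟨ cong₂ (λ n m → zip n (false ∷ m)) binN binM ⟩
  zip (bin x ++ b ∷ u) (false ∷ bin x ++ v)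
    ≡⟨ cong (λ n → zip n (false ∷ bin x ++ v)) (sym (++-assoc (bin x) (b ∷ []) u)) ⟩
  zip ((bin x ++ b ∷ []) ++ u) ((false ∷ bin x) ++ v)
    ≡⟨ zip-++ (bin x ++ b ∷ []) (false ∷ bin x) (trans (length-++ (bin x)) (+-comm (length (bin x)) 1)) ⟩
  zip (bin x ++ b ∷ []) (false ∷ bin x) ++ zip u v ∎
  where
  binN : bin (appendDigits x (b ∷ u)) ≡ bin x ++ b ∷ u
  binN = bin-appendDigits (b ∷ u) 1≤x
  binM : bin (appendDigits x v) ≡ bin x ++ v
  binM = bin-appendDigits v 1≤x
  lengths : length (bin (appendDigits x (b ∷ u))) ≡ suc (length (bin (appendDigits x v)))
  lengths = begin
    length (bin (appendDigits x (b ∷ u)))   ≡⟨ cong length binN ⟩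
    length (bin x ++ b ∷ u)                 ≡⟨ length-++ (bin x) ⟩
    length (bin x) + suc (length u)         ≡⟨ +-suc (length (bin x)) (length u) ⟩
    suc (length (bin x) + length u)         ≡⟨ cong (λ ℓ → suc (length (bin x) + ℓ)) ℓu≡ℓv ⟩
    suc (length (bin x) + length v)         ≡⟨ cong suc (length-++ (bin x)) ⟨
    suc (length (bin x ++ v))               ≡⟨ cong (λ w → suc (length w)) binM ⟨
    suc (length (bin (appendDigits x v)))   ∎

appendDigits-complement : ∀ x y v →
  appendDigits x (map not v) + appendDigits y v ≡ appendDigits (x + y) (replicate (length v) true)
appendDigits-complement x y []      = refl
appendDigits-complement x y (b ∷ v) = begin
  appendDigits (2 * x + bit (not b)) (map not v) + appendDigits (2 * y + bit b) v
    ≡⟨ appendDigits-complement (2 * x + bit (not b)) (2 * y + bit b) v ⟩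
  appendDigits (2 * x + bit (not b) + (2 * y + bit b)) (replicate (length v) true)
    ≡⟨ cong (λ z → appendDigits z (replicate (length v) true)) (bits-complement b) ⟩
  appendDigits (2 * (x + y) + 1) (replicate (length v) true) ∎
  where
  bits-complement : ∀ b → 2 * x + bit (not b) + (2 * y + bit b) ≡ 2 * (x + y) + 1
  bits-complement false = solve (x ∷ y ∷ [])
  bits-complement true  = solve (x ∷ y ∷ [])

halve : ∀ c → Σ ℕ λ q → Σ Bool λ r → 2 * q + bit r ≡ c
halve 0 = 0 , false , refl
halve 1 = 0 , true , refl
halve (suc (suc c)) with halve c
... | q , r , refl = suc q , r , cong (_+ bit r) (*-suc 2 q)

fixedWidthDigits : ∀ K c → c < 2 ^ K → Σ (List Bool) λ w → length w ≡ K × appendDigits 0 w ≡ c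
fixedWidthDigits zero    zero    _ = [] , refl , refl
fixedWidthDigits zero    (suc c) (s≤s ())
fixedWidthDigits (suc K) c c<2^[1+K] with halve c
... | q , r , refl
    with fixedWidthDigits K q (*-cancelˡ-< 2 q (2 ^ K) (≤-<-trans (m≤m+n (2 * q) (bit r)) c<2^[1+K]))
... | w , refl , refl = w ++ r ∷ [] , trans (length-++ w) (+-comm (length w) 1) , appendDigits-++ 0 w (r ∷ [])

n<2^n : ∀ n → n < 2 ^ n
n<2^n zero    = z<s
n<2^n (suc n) = +-mono-≤ (m^n>0 2 n) (≤-trans (n<2^n n) (m≤m+n (2 ^ n) 0))

complementDigits : ∀ K c → c < 2 ^ K →
  Σ (List Bool) λ v → length v ≡ K × (∀ x → appendDigits x v + c ≡ appendDigits x (replicate K true))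
complementDigits K c c<2^K with fixedWidthDigits K c c<2^K
... | w , refl , refl = map not w , length-map not w , λ x →
  trans (appendDigits-complement x 0 w) (cong (λ z → appendDigits z (replicate (length w) true)) (+-identityʳ x))

prefix-pigeonhole : (A : DFA) (p : Fin (suc (DFA.size A)) → List (Bool × Bool)) →
  ∃₂ λ i j → toℕ i < toℕ j × (∀ w → accepts A (p i ++ w) ≡ accepts A (p j ++ w))
prefix-pigeonhole A p =
  let i , j , i<j , sameState = pigeonhole (n<1+n size) (λ k → foldl δ start (p k))
  in i , j , i<j , λ w → begin
    accepts A (p i ++ w)                     ≡⟨ cong accept (foldl-++ δ start (p i) w) ⟩
    accept (foldl δ (foldl δ start (p i)) w) ≡⟨ cong (λ q → accept (foldl δ q w)) sameState ⟩
    accept (foldl δ (foldl δ start (p j)) w) ≡⟨ cong accept (foldl-++ δ start (p j) w) ⟨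
    accepts A (p j ++ w)                     ∎
  where open DFA A

m+o≡n+p⇒[m≡n⇔o≡p] : ∀ {m n o p} → m + o ≡ n + p → (m ≡ n) ⇔ (o ≡ p)
m+o≡n+p⇒[m≡n⇔o≡p] {m} {n} {o} {p} eq = mk⇔
  (λ { refl → +-cancelˡ-≡ m o p eq })
  (λ { refl → +-cancelʳ-≡ o m n eq })

unboundedDefect⇒¬Synchronised2 : (g B : ℕ → ℕ) → (∀ i → 1 ≤ B i) →
  (∀ i K → g (2 * appendDigits (B i) (replicate K true)) + i ≡ appendDigits (B i) (replicate K true)) →
  ¬ Synchronised2 g
unboundedDefect⇒¬Synchronised2 g B 1≤B defect (A , graph) =
  let i , j , i<j , samePrefix = prefix-pigeonhole A (λ k → prefix (toℕ k))
      acceptedAfter-i = subst T (sym (samePrefix (zip u (suffix j)))) (Equivalence.from (accepts⇔ (toℕ j) j) refl)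
  in <-irrefl (sym (Equivalence.to (accepts⇔ (toℕ i) j) acceptedAfter-i)) i<j
  where
  open DFA A using (size)
  K : ℕ
  K = suc size
  u : List Bool
  u = replicate size true ++ false ∷ []
  u-length : length u ≡ K
  u-length = begin
    length (replicate size true ++ false ∷ []) ≡⟨ length-++ (replicate size true) ⟩
    length (replicate size true) + 1           ≡⟨ cong (_+ 1) (length-replicate size) ⟩
    size + 1                                   ≡⟨ +-comm size 1 ⟩
    K                                          ∎
  Y : ℕ → ℕ
  Y i = appendDigits (B i) (replicate K true)
  -- input i = 2 * Y i has one digit more than g (input i) = Y i ∸ i; the prefix absorbs the extra digit.
  input : ℕ → ℕ
  input i = appendDigits (B i) (true ∷ u)
  g[input]+i≡Y : ∀ i → g (input i) + i ≡ Y i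
  g[input]+i≡Y i = begin
    g (appendDigits (B i) (replicate K true ++ false ∷ [])) + i
      ≡⟨ cong (λ n → g n + i) (appendDigits-++ (B i) (replicate K true) (false ∷ [])) ⟩
    g (2 * Y i + 0) + i ≡⟨ cong (λ n → g n + i) (+-identityʳ (2 * Y i)) ⟩
    g (2 * Y i) + i     ≡⟨ defect i K ⟩
    Y i                 ∎
  prefix : ℕ → List (Bool × Bool)
  prefix i = zip (bin (B i) ++ true ∷ []) (false ∷ bin (B i))
  toℕ<2^K : ∀ k → toℕ {K} k < 2 ^ K
  toℕ<2^K k = <-trans (toℕ<n k) (n<2^n K)
  suffix : Fin K → List Bool
  suffix k = proj₁ (complementDigits K (toℕ k) (toℕ<2^K k))
  suffix-length : ∀ k → length (suffix k) ≡ K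
  suffix-length k = proj₁ (proj₂ (complementDigits K (toℕ k) (toℕ<2^K k)))
  suffix-value : ∀ k x → appendDigits x (suffix k) + toℕ k ≡ appendDigits x (replicate K true)
  suffix-value k = proj₂ (proj₂ (complementDigits K (toℕ k) (toℕ<2^K k)))
  accepts⇔ : ∀ i k → T (accepts A (prefix i ++ zip u (suffix k))) ⇔ (toℕ k ≡ i)
  accepts⇔ i k =
    subst (λ w → T (accepts A w) ⇔ (toℕ k ≡ i))
          (pairRep-appendDigits true u (suffix k) (1≤B i) (trans u-length (sym (suffix-length k))))
          (⇔-trans (graph (input i) (appendDigits (B i) (suffix k)))
                   (m+o≡n+p⇒[m≡n⇔o≡p] (trans (suffix-value k (B i)) (sym (g[input]+i≡Y i)))))

module PaperFolding (f : ℕ → ℕ)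
  (f[2n+1]≡f[n] : ∀ n → f (2 * n + 1) ≡ f n)
  (f[4n]≡0 : ∀ n → f (4 * n) ≡ 0)
  (f[4n+2]≡1 : ∀ n → f (4 * n + 2) ≡ 1)
  where

  S E : ℕ → ℕ
  S = runningSum f
  E = runningSum (λ j → f (2 * j))

  f[2n+1]≡f[n]′ : ∀ {m} n → m ≡ 2 * n + 1 → f m ≡ f n
  f[2n+1]≡f[n]′ n refl = f[2n+1]≡f[n] n

  f[4n]≡0′ : ∀ {m} n → m ≡ 4 * n → f m ≡ 0
  f[4n]≡0′ n refl = f[4n]≡0 n

  f[4n+2]≡1′ : ∀ {m} n → m ≡ 4 * n + 2 → f m ≡ 1
  f[4n+2]≡1′ n refl = f[4n+2]≡1 n

  E[2k]≡k     : ∀ k → E (2 * k) ≡ k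
  E[2k+1]≡1+k : ∀ k → E (2 * k + 1) ≡ suc k

  E[2k]≡k zero    = f[4n]≡0 0
  E[2k]≡k (suc k) = begin
    E (2 * suc k)
      ≡⟨ cong E (*-suc 2 k) ⟩
    E (suc (2 * k)) + f (2 * suc (suc (2 * k)))
      ≡⟨ cong₂ _+_ (trans (cong E (+-comm 1 (2 * k))) (E[2k+1]≡1+k k)) (f[4n]≡0′ (suc k) (solve (k ∷ []))) ⟩
    suc k + 0
      ≡⟨ +-identityʳ (suc k) ⟩
    suc k ∎

  E[2k+1]≡1+k k = begin
    E (2 * k + 1)                   ≡⟨ cong E (+-comm (2 * k) 1) ⟩
    E (2 * k) + f (2 * suc (2 * k)) ≡⟨ cong₂ _+_ (E[2k]≡k k) (f[4n+2]≡1′ k (solve (k ∷ []))) ⟩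
    k + 1                           ≡⟨ +-comm k 1 ⟩
    suc k                           ∎

  S[2n+1]≡S[n]+E[n] : ∀ n → S (2 * n + 1) ≡ S n + E n
  S[2n+1]≡S[n]+E[n] zero    = cong (f 0 +_) (f[2n+1]≡f[n] 0)
  S[2n+1]≡S[n]+E[n] (suc n) = begin
    S (2 * suc n + 1)                                  ≡⟨ cong (λ m → S (m + 1)) (*-suc 2 n) ⟩
    S (2 * n + 1) + f (suc (2 * n + 1)) + f (suc (suc (2 * n + 1)))
      ≡⟨ cong₂ (λ s t → s + f t + f (suc (suc (2 * n + 1)))) (S[2n+1]≡S[n]+E[n] n) (solve (n ∷ [])) ⟩
    S n + E n + f (2 * suc n) + f (suc (suc (2 * n + 1)))
      ≡⟨ cong (S n + E n + f (2 * suc n) +_) (f[2n+1]≡f[n]′ (suc n) (solve (n ∷ []))) ⟩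
    S n + E n + f (2 * suc n) + f (suc n)              ≡⟨ interchange (S n) (E n) (f (2 * suc n)) (f (suc n)) ⟩
    S n + f (suc n) + (E n + f (2 * suc n))            ∎
    where
    interchange : ∀ a b c d → a + b + c + d ≡ a + d + (b + c)
    interchange = solve-∀

  S[2[2y+1]]≡S[2y]+y+1 : ∀ y → S (2 * (2 * y + 1)) ≡ S (2 * y) + y + 1
  S[2[2y+1]]≡S[2y]+y+1 y = begin
    S (2 * (2 * y + 1))
      ≡⟨ cong S (index y) ⟩
    S (2 * (2 * y) + 1) + f (suc (2 * (2 * y) + 1))
      ≡⟨ cong₂ _+_ (S[2n+1]≡S[n]+E[n] (2 * y)) (f[4n+2]≡1′ y (solve (y ∷ []))) ⟩
    S (2 * y) + E (2 * y) + 1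
      ≡⟨ cong (λ e → S (2 * y) + e + 1) (E[2k]≡k y) ⟩
    S (2 * y) + y + 1 ∎
    where
    index : ∀ y → 2 * (2 * y + 1) ≡ suc (2 * (2 * y) + 1)
    index = solve-∀

  S[2[4y+2]]≡S[2y]+y+[2y+1] : ∀ y → S (2 * (4 * y + 2)) ≡ S (2 * y) + y + suc (2 * y)
  S[2[4y+2]]≡S[2y]+y+[2y+1] y = begin
    S (2 * (4 * y + 2))
      ≡⟨ cong S (index y) ⟩
    S (2 * (2 * (2 * y) + 1) + 1) + f (suc (2 * (2 * (2 * y) + 1) + 1))
      ≡⟨ cong₂ _+_ (S[2n+1]≡S[n]+E[n] (2 * (2 * y) + 1)) (f[4n]≡0′ (2 * y + 1) (solve (y ∷ []))) ⟩
    S (2 * (2 * y) + 1) + E (2 * (2 * y) + 1) + 0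
      ≡⟨ +-identityʳ _ ⟩
    S (2 * (2 * y) + 1) + E (2 * (2 * y) + 1)
      ≡⟨ cong₂ _+_ (S[2n+1]≡S[n]+E[n] (2 * y)) (E[2k+1]≡1+k (2 * y)) ⟩
    S (2 * y) + E (2 * y) + suc (2 * y)
      ≡⟨ cong (λ e → S (2 * y) + e + suc (2 * y)) (E[2k]≡k y) ⟩
    S (2 * y) + y + suc (2 * y) ∎
    where
    index : ∀ y → 2 * (4 * y + 2) ≡ suc (2 * (2 * (2 * y) + 1) + 1)
    index = solve-∀

  defect-appendOne : ∀ {y c} → S (2 * y) + c ≡ y → S (2 * (2 * y + 1)) + c ≡ 2 * y + 1
  defect-appendOne {y} {c} d = begin
    S (2 * (2 * y + 1)) + c   ≡⟨ cong (_+ c) (S[2[2y+1]]≡S[2y]+y+1 y) ⟩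
    S (2 * y) + y + 1 + c     ≡⟨ rearrange (S (2 * y)) y c ⟩
    S (2 * y) + c + y + 1     ≡⟨ cong (λ t → t + y + 1) d ⟩
    y + y + 1                 ≡⟨ solve (y ∷ []) ⟩
    2 * y + 1                 ∎
    where
    rearrange : ∀ s y c → s + y + 1 + c ≡ s + c + y + 1
    rearrange = solve-∀

  defect-appendOneZero : ∀ {y c} → S (2 * y) + c ≡ y → S (2 * (4 * y + 2)) + suc c ≡ 4 * y + 2
  defect-appendOneZero {y} {c} d = begin
    S (2 * (4 * y + 2)) + suc c           ≡⟨ cong (_+ suc c) (S[2[4y+2]]≡S[2y]+y+[2y+1] y) ⟩
    S (2 * y) + y + suc (2 * y) + suc c   ≡⟨ rearrange (S (2 * y)) y c ⟩
    S (2 * y) + c + 3 * y + 2             ≡⟨ cong (λ t → t + 3 * y + 2) d ⟩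
    y + 3 * y + 2                         ≡⟨ solve (y ∷ []) ⟩
    4 * y + 2                             ∎
    where
    rearrange : ∀ s y c → s + y + suc (2 * y) + suc c ≡ s + c + 3 * y + 2
    rearrange = solve-∀

  defect-appendOnes : ∀ {x c} → S (2 * x) + c ≡ x → ∀ K →
    S (2 * appendDigits x (replicate K true)) + c ≡ appendDigits x (replicate K true)
  defect-appendOnes d zero    = d
  defect-appendOnes d (suc K) = defect-appendOnes (defect-appendOne d) K

  -- block i is 1(10)^i in binary.
  block : ℕ → ℕ
  block zero    = 1
  block (suc i) = 4 * block i + 2

  1≤block : ∀ i → 1 ≤ block i
  1≤block zero    = s≤s z≤n
  1≤block (suc i) = ≤-trans (s≤s z≤n) (m≤n+m 2 (4 * block i))

  defect-block : ∀ i → S (2 * block i) + i ≡ block i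
  defect-block zero    rewrite f[2n+1]≡f[n] 0 | f[4n]≡0 0 | f[4n+2]≡1 0 = refl
  defect-block (suc i) = defect-appendOneZero (defect-block i)

mainTheorem6 : (f : ℕ → ℕ) → (∀ n → f (2 * n + 1) ≡ f n) → (∀ n → f (4 * n) ≡ 0) → (∀ n → f (4 * n + 2) ≡ 1) → ¬ Synchronised2 (runningSum f)
mainTheorem6 f f[2n+1]≡f[n] f[4n]≡0 f[4n+2]≡1 =
  unboundedDefect⇒¬Synchronised2 S block 1≤block (λ i → defect-appendOnes (defect-block i))
  where open PaperFolding f f[2n+1]≡f[n] f[4n]≡0 f[4n+2]≡1
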